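{- Let $T$ be a non-trivial min-cut tree of a simple graph $G$. Let $A$ be a block of degree $r$ in $T$ whose neighbors $B_1,\dots,B_r$ in $T$ all have degree $2$ in $T$, and suppose $|A|=|B_1|=\dots=|B_r|=1$. Then $\delta(G)\leq r^2+r$.
   Context: For $X\subseteq V$, $d_G(X)$ is the number of edges with exactly one endpoint in $X$. A cut is a set $\emptyset\neq X\subsetneq V$; trivial if $|X|=1$ or $|V\setminus X|=1$. $\lambda(G)=\min_X d_G(X)$; a min-cut is a cut with $d_G(X)=\lambda(G)$; $X$ separates $a,b$ if exactly one lies in $X$. For a tree $T$ whose vertex set (blocks) is a partition of $V$ and an edge $AB$, $C_{AB}$ is the union of blocks in the component of $T-AB$ containing $A$. A non-trivial min-cut tree is such a tree with: (i) for every edge $AB$, $C_{AB}$ is a non-trivial min-cut of $G$; (ii) every two vertices separated by some non-trivial min-cut of $G$ are separated by $C_{AB}$ for some edge $AB$ of $T$. -}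

module Defs where

open import Data.Nat using (ℕ; zero; suc; _+_; _*_; _≤_; _⊓_)
open import Data.Bool using (Bool; true; false; _∧_; _∨_; not; if_then_else_)
open import Data.Fin using (Fin; _≟_)
open import Data.List using (List; map; foldr; allFin)
open import Data.Nat.ListAction using (sum)
open import Data.Product using (Σ; ∃; _×_; _,_)
open import Data.Sum using (_⊎_)
open import Relation.Nullary using (¬_)
open import Relation.Nullary.Decidable using (⌊_⌋)
open import Relation.Binary.PropositionalEquality using (_≡_; _≢_)
open import Function.Bundles using (_⇔_)

count : ∀ {n} → (Fin n → Bool) → ℕ
count {n} p = sum (map (λ i → if p i then 1 else 0) (allFin n))

record Graph : Set where
  field
    n     : ℕ
    adj   : Fin n → Fin n → Bool
    sym   : ∀ u v → adj u v ≡ adj v u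
    irref : ∀ v → adj v v ≡ false

module _ (G : Graph) where
  open Graph G

  VSet : Set
  VSet = Fin n → Bool

  degree : Fin n → ℕ
  degree v = count (adj v)

  -- minimum degree δ(G): minimum of the degrees (initial value n exceeds
  -- every degree, so for n ≥ 1 this is exactly the minimum degree)
  δ : ℕ
  δ = foldr (λ v acc → degree v ⊓ acc) n (allFin n)

  -- d_G(X): number of edges with exactly one endpoint in X
  -- (each such edge counted once, as the ordered pair (u,v) with u ∈ X, v ∉ X)
  d : VSet → ℕ
  d X = sum (map (λ u → count (λ v → X u ∧ not (X v) ∧ adj u v)) (allFin n))

  IsCut : VSet → Set
  IsCut X = (∃ λ u → X u ≡ true) × (∃ λ v → X v ≡ false)

  IsNonTrivial : VSet → Set
  IsNonTrivial X = (2 ≤ count X) × (2 ≤ count (λ v → not (X v)))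

  IsMinCut : VSet → Set
  IsMinCut X = IsCut X × (∀ Y → IsCut Y → d X ≤ d Y)

  IsNonTrivialMinCut : VSet → Set
  IsNonTrivialMinCut X = IsMinCut X × IsNonTrivial X

  Separates : VSet → Fin n → Fin n → Set
  Separates X a b = X a ≢ X b

data Reach {m : ℕ} (R : Fin m → Fin m → Bool) : Fin m → Fin m → Set where
  here : ∀ {x} → Reach R x x
  step : ∀ {x y z} → R x y ≡ true → Reach R y z → Reach R x z

-- A tree on Fin m given by a symmetric loopless edge relation:
-- connected, and every edge is a bridge (acyclic).
module _ {m : ℕ} (te : Fin m → Fin m → Bool) where
  minusEdge : Fin m → Fin m → Fin m → Fin m → Bool
  minusEdge A B x y =
    te x y ∧ not ((⌊ x ≟ A ⌋ ∧ ⌊ y ≟ B ⌋) ∨ (⌊ x ≟ B ⌋ ∧ ⌊ y ≟ A ⌋))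

  -- C_AB membership for a block: X lies in the component of T - AB containing A
  InCAB : Fin m → Fin m → Fin m → Set
  InCAB A B X = Reach (minusEdge A B) A X

-- A non-trivial min-cut tree of G.  Blocks are Fin m; block β v is the block
-- containing vertex v (so the blocks partition V), every block is nonempty.
record NTMinCutTree (G : Graph) : Set where
  open Graph G
  field
    m      : ℕ
    te     : Fin m → Fin m → Bool
    tsym   : ∀ A B → te A B ≡ te B A
    tirref : ∀ A → te A A ≡ false
    connected : ∀ A B → Reach te A B
    acyclic   : ∀ A B → te A B ≡ true → ¬ Reach (minusEdge te A B) A B
    β      : Fin n → Fin m
    βsurj  : ∀ A → ∃ λ v → β v ≡ A
    cond-i : ∀ A B → te A B ≡ true →
             ∃ λ (X : VSet G) →
               (∀ v → (X v ≡ true) ⇔ InCAB te A B (β v)) × IsNonTrivialMinCut G X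
    cond-ii : ∀ a b → (∃ λ (X : VSet G) → IsNonTrivialMinCut G X × Separates G X a b) →
              ∃ λ A → ∃ λ B → te A B ≡ true ×
                ((InCAB te A B (β a) × ¬ InCAB te A B (β b)) ⊎
                 (¬ InCAB te A B (β a) × InCAB te A B (β b)))

  degT : Fin m → ℕ
  degT A = count (te A)

  size : Fin m → ℕ
  size A = count (λ v → ⌊ β v ≟ A ⌋)

module Submission where

-- Let N[A] = {A, B₁, …, B_r} be the closed neighbourhood of A in T and W ⊆ V(G) the union of
-- its blocks, so |W| = r + 1.
--  * Lower bound.  A vertex of W has fewer than |W| neighbours inside W, so at least δ + 1 - |W|
--    edges leave W at it; summing over W gives |W|·(δ + 1) ≤ |W|² + d(W).
--  * Upper bound.  Each B_i has exactly one T-neighbour D_i ≠ A.  The tree path from A to a block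
--    outside N[A] leaves N[A] along some edge B_i D_i, so every edge of G leaving W is cut by one
--    of the r min-cuts C_{D_i B_i}.  A min-cut is no larger than a trivial cut, i.e. than δ, so
--    d(W) ≤ r·δ.
-- Hence (r + 1)(δ + 1) ≤ (r + 1)² + r·δ, which is δ ≤ r² + r.

open import Defs
open import Data.Nat using (ℕ; zero; suc; _+_; _*_; _≤_; _<_; z≤n; s≤s; _⊓_)
open import Data.Nat.Properties hiding (_≟_)
open import Algebra.Properties.Semiring.Sum +-*-semiring using (sum; sum-syntax; sum-cong-≗; sum-remove; sum-replicate-zero; ∑-comm; ∑-distrib-+; *-distribʳ-sum)
open import Data.Nat.ListAction using () renaming (sum to listSum)
open import Data.Nat.Tactic.RingSolver using (solve-∀)
open import Data.Bool using (Bool; true; false; _∧_; _∨_; not; if_then_else_)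
open import Data.Bool.Properties using (∧-zeroʳ; ∧-identityʳ; ∨-zeroʳ)
open import Data.Fin using (Fin; zero; suc; _≟_; punchIn)
open import Data.Fin.Properties using (punchInᵢ≢i)
open import Data.List using (List; []; _∷_; map; foldr; allFin; tabulate)
open import Data.List.Membership.Propositional using (_∈_)
open import Data.List.Membership.Propositional.Properties using (∈-allFin)
open import Data.List.Relation.Unary.Any using (here; there)
open import Data.Product using (∃; ∃₂; _×_; _,_; proj₁; proj₂)
open import Data.Sum using (_⊎_; inj₁; inj₂)
open import Data.Empty using (⊥; ⊥-elim)
open import Relation.Nullary using (¬_; yes; no)
open import Relation.Nullary.Decidable using (⌊_⌋; isYes≗does; dec-true; dec-false)
open import Relation.Binary.PropositionalEquality
open import Function using (_∘_; id)
open import Function.Bundles using (_⇔_; Equivalence)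

≟-refl : ∀ {k} (x : Fin k) → ⌊ x ≟ x ⌋ ≡ true
≟-refl x = trans (isYes≗does (x ≟ x)) (dec-true (x ≟ x) refl)

≟-false : ∀ {k} {x y : Fin k} → x ≢ y → ⌊ x ≟ y ⌋ ≡ false
≟-false {x = x} {y} x≢y = trans (isYes≗does (x ≟ y)) (dec-false (x ≟ y) x≢y)

true≢false : ∀ {b : Bool} → b ≡ true → b ≡ false → ⊥
true≢false refl ()

not-true : ∀ {b : Bool} → not b ≡ true → b ≡ false
not-true {false} _ = refl

∧-true : ∀ {a b : Bool} → a ∧ b ≡ true → a ≡ true × b ≡ true
∧-true {true} {true} _ = refl , refl

≟∧≟-false : ∀ {k} {x y z w : Fin k} → x ≢ y ⊎ z ≢ w → (⌊ x ≟ y ⌋ ∧ ⌊ z ≟ w ⌋) ≡ false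
≟∧≟-false (inj₁ x≢y) rewrite ≟-false x≢y = refl
≟∧≟-false {x = x} {y} (inj₂ z≢w) rewrite ≟-false z≢w = ∧-zeroʳ ⌊ x ≟ y ⌋

-- Finite sums over Fin n.  ind b x is x when b holds and 0 otherwise, and card p is the number
-- of points satisfying p; Defs counts with list sums over allFin, which agree with these.

ind : Bool → ℕ → ℕ
ind b x = if b then x else 0

card : ∀ {n} → (Fin n → Bool) → ℕ
card {n} p = ∑[ i < n ] ind (p i) 1

listSum-tabulate : ∀ {A : Set} {n} (f : A → ℕ) (g : Fin n → A) →
                   listSum (map f (tabulate g)) ≡ ∑[ i < n ] f (g i)
listSum-tabulate {n = zero} f g = refl
listSum-tabulate {n = suc n} f g = cong (f (g zero) +_) (listSum-tabulate f (g ∘ suc))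

listSum-allFin : ∀ {n} (f : Fin n → ℕ) → listSum (map f (allFin n)) ≡ sum f
listSum-allFin f = listSum-tabulate f id

count≡card : ∀ {n} (p : Fin n → Bool) → count p ≡ card p
count≡card p = listSum-allFin (λ i → ind (p i) 1)

sum-mono-≤ : ∀ {n} {f g : Fin n → ℕ} → (∀ i → f i ≤ g i) → sum f ≤ sum g
sum-mono-≤ {zero} _ = z≤n
sum-mono-≤ {suc n} f≤g = +-mono-≤ (f≤g zero) (sum-mono-≤ (f≤g ∘ suc))

sum-mono-< : ∀ {n} {f g : Fin n → ℕ} (u : Fin n) → (∀ i → f i ≤ g i) → f u < g u → sum f < sum g
sum-mono-< zero f≤g fu<gu = +-mono-<-≤ fu<gu (sum-mono-≤ (f≤g ∘ suc))
sum-mono-< (suc u) f≤g fu<gu = +-mono-≤-< (f≤g zero) (sum-mono-< u (f≤g ∘ suc) fu<gu)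

term≤sum : ∀ {n} (f : Fin n → ℕ) (i : Fin n) → f i ≤ sum f
term≤sum f zero = m≤m+n _ _
term≤sum f (suc i) = ≤-trans (term≤sum (f ∘ suc) i) (m≤n+m _ _)

sum-single : ∀ {n} (f : Fin n → ℕ) (i : Fin n) → (∀ j → j ≢ i → f j ≡ 0) → sum f ≡ f i
sum-single {suc n} f i vanish = begin
    sum f                               ≡⟨ sum-remove {i = i} f ⟩
    f i + ∑[ j < n ] f (punchIn i j)    ≡⟨ cong (f i +_) rest-zero ⟩
    f i + 0                             ≡⟨ +-identityʳ (f i) ⟩
    f i                                 ∎
  where
    open ≡-Reasoning
    rest-zero : ∑[ j < n ] f (punchIn i j) ≡ 0
    rest-zero = trans (sum-cong-≗ (λ j → vanish (punchIn i j) (punchInᵢ≢i i j)))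
                      (sum-replicate-zero n)

sum-ind : ∀ {n} (b : Bool) (f : Fin n → ℕ) → ∑[ i < n ] ind b (f i) ≡ ind b (sum f)
sum-ind true f = refl
sum-ind {n} false f = sum-replicate-zero n

sum-ind-const : ∀ {n} (p : Fin n → Bool) (c : ℕ) → ∑[ i < n ] ind (p i) c ≡ card p * c
sum-ind-const p c = sym (trans (*-distribʳ-sum c (λ i → ind (p i) 1)) (sum-cong-≗ (λ i → ind-1* (p i))))
  where
    ind-1* : ∀ b → ind b 1 * c ≡ ind b c
    ind-1* true = +-identityʳ c
    ind-1* false = refl

card≤ : ∀ {n} (p : Fin n → Bool) → card p ≤ n
card≤ {zero} p = z≤n
card≤ {suc n} p with p zero
... | true = s≤s (card≤ (p ∘ suc))
... | false = m≤n⇒m≤1+n (card≤ (p ∘ suc))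

card-singleton : ∀ {n} (a : Fin n) → card (λ i → ⌊ i ≟ a ⌋) ≡ 1
card-singleton a = trans (sum-single _ a (λ j j≢a → cong (λ b → ind b 1) (≟-false j≢a)))
                         (cong (λ b → ind b 1) (≟-refl a))

card-remove : ∀ {n} (p : Fin n → Bool) (a : Fin n) → p a ≡ true →
              card p ≡ suc (card (λ i → p i ∧ not ⌊ i ≟ a ⌋))
card-remove {n} p a pa = begin
    card p
      ≡⟨ sum-cong-≗ split ⟩
    ∑[ i < n ] (ind ⌊ i ≟ a ⌋ 1 + ind (p i ∧ not ⌊ i ≟ a ⌋) 1)
      ≡⟨ ∑-distrib-+ (λ i → ind ⌊ i ≟ a ⌋ 1) (λ i → ind (p i ∧ not ⌊ i ≟ a ⌋) 1) ⟩
    card (λ i → ⌊ i ≟ a ⌋) + card (λ i → p i ∧ not ⌊ i ≟ a ⌋)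
      ≡⟨ cong (_+ card (λ i → p i ∧ not ⌊ i ≟ a ⌋)) (card-singleton a) ⟩
    suc (card (λ i → p i ∧ not ⌊ i ≟ a ⌋)) ∎
  where
    open ≡-Reasoning
    split : ∀ i → ind (p i) 1 ≡ ind ⌊ i ≟ a ⌋ 1 + ind (p i ∧ not ⌊ i ≟ a ⌋) 1
    split i with i ≟ a
    ... | yes refl rewrite pa = refl
    ... | no _ rewrite ∧-identityʳ (p i) = refl

card-fibres : ∀ {n m} (β : Fin n → Fin m) (S : Fin m → Bool) →
              card (S ∘ β) ≡ ∑[ Z < m ] ind (S Z) (card (λ u → ⌊ β u ≟ Z ⌋))
card-fibres {n} {m} β S = begin
    card (S ∘ β)
      ≡⟨ sum-cong-≗ (λ u → sym (own-fibre u)) ⟩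
    ∑[ u < n ] ∑[ Z < m ] ind (S Z) (ind ⌊ β u ≟ Z ⌋ 1)
      ≡⟨ ∑-comm (λ u Z → ind (S Z) (ind ⌊ β u ≟ Z ⌋ 1)) ⟩
    ∑[ Z < m ] ∑[ u < n ] ind (S Z) (ind ⌊ β u ≟ Z ⌋ 1)
      ≡⟨ sum-cong-≗ (λ Z → sum-ind (S Z) (λ u → ind ⌊ β u ≟ Z ⌋ 1)) ⟩
    ∑[ Z < m ] ind (S Z) (card (λ u → ⌊ β u ≟ Z ⌋)) ∎
  where
    open ≡-Reasoning
    ind-0 : ∀ b → ind b 0 ≡ 0
    ind-0 true = refl
    ind-0 false = refl
    own-fibre : ∀ u → ∑[ Z < m ] ind (S Z) (ind ⌊ β u ≟ Z ⌋ 1) ≡ ind (S (β u)) 1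
    own-fibre u = trans (sum-single _ (β u) (λ Z Z≢βu → trans (cong (λ b → ind (S Z) (ind b 1)) (≟-false (Z≢βu ∘ sym))) (ind-0 (S Z))))
                        (cong (λ b → ind (S (β u)) (ind b 1)) (≟-refl (β u)))

∑∑-interchange : ∀ {a b c e} (f : Fin a → Fin b → Fin c → Fin e → ℕ) →
  ∑[ x < a ] ∑[ y < b ] ∑[ i < c ] ∑[ j < e ] f x y i j ≡
  ∑[ i < c ] ∑[ j < e ] ∑[ x < a ] ∑[ y < b ] f x y i j
∑∑-interchange {a} {b} {c} {e} f = begin
    ∑[ x < a ] ∑[ y < b ] ∑[ i < c ] ∑[ j < e ] f x y i j
      ≡⟨ sum-cong-≗ (λ x → ∑-comm (λ y i → ∑[ j < e ] f x y i j)) ⟩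
    ∑[ x < a ] ∑[ i < c ] ∑[ y < b ] ∑[ j < e ] f x y i j
      ≡⟨ sum-cong-≗ (λ x → sum-cong-≗ (λ i → ∑-comm (λ y j → f x y i j))) ⟩
    ∑[ x < a ] ∑[ i < c ] ∑[ j < e ] ∑[ y < b ] f x y i j
      ≡⟨ ∑-comm (λ x i → ∑[ j < e ] ∑[ y < b ] f x y i j) ⟩
    ∑[ i < c ] ∑[ x < a ] ∑[ j < e ] ∑[ y < b ] f x y i j
      ≡⟨ sum-cong-≗ (λ i → ∑-comm (λ x j → ∑[ y < b ] f x y i j)) ⟩
    ∑[ i < c ] ∑[ j < e ] ∑[ x < a ] ∑[ y < b ] f x y i j ∎
  where open ≡-Reasoning

foldr-⊓-≤ : ∀ {A : Set} (f : A → ℕ) (c : ℕ) {x : A} {xs : List A} → x ∈ xs →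
            foldr (λ v acc → f v ⊓ acc) c xs ≤ f x
foldr-⊓-≤ f c (here refl) = m⊓n≤m _ _
foldr-⊓-≤ f c (there x∈xs) = ≤-trans (m⊓n≤n _ _) (foldr-⊓-≤ f c x∈xs)

foldr-⊓-glb : ∀ {A : Set} (f : A → ℕ) {c k : ℕ} (xs : List A) → k ≤ c → (∀ x → k ≤ f x) →
              k ≤ foldr (λ v acc → f v ⊓ acc) c xs
foldr-⊓-glb f [] k≤c _ = k≤c
foldr-⊓-glb f (x ∷ xs) k≤c k≤f = ⊓-glb (k≤f x) (foldr-⊓-glb f xs k≤c k≤f)

module _ (G : Graph) where
  open Graph G renaming (sym to adj-sym)

  leaves : VSet G → Fin n → Fin n → Bool
  leaves X u v = X u ∧ not (X v) ∧ adj u v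

  d≡sum : ∀ X → d G X ≡ ∑[ u < n ] card (leaves X u)
  d≡sum X = trans (listSum-allFin (λ u → count (leaves X u))) (sum-cong-≗ (λ u → count≡card (leaves X u)))

  δ≤degree : ∀ u → δ G ≤ degree G u
  δ≤degree u = foldr-⊓-≤ (degree G) n (∈-allFin u)

  d-singleton : ∀ v → d G (λ x → ⌊ x ≟ v ⌋) ≡ degree G v
  d-singleton v = begin
      d G (λ x → ⌊ x ≟ v ⌋)
        ≡⟨ d≡sum (λ x → ⌊ x ≟ v ⌋) ⟩
      ∑[ u < n ] card (leaves (λ x → ⌊ x ≟ v ⌋) u)
        ≡⟨ sum-single _ v (λ u u≢v → trans (sum-cong-≗ (other-row u≢v)) (sum-replicate-zero n)) ⟩
      card (leaves (λ x → ⌊ x ≟ v ⌋) v)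
        ≡⟨ sum-cong-≗ own-row ⟩
      card (adj v)
        ≡⟨ sym (count≡card (adj v)) ⟩
      degree G v ∎
    where
      open ≡-Reasoning
      other-row : ∀ {u} → u ≢ v → ∀ x → ind (⌊ u ≟ v ⌋ ∧ not ⌊ x ≟ v ⌋ ∧ adj u x) 1 ≡ 0
      other-row {u} u≢v x = cong (λ b → ind (b ∧ not ⌊ x ≟ v ⌋ ∧ adj u x) 1) (≟-false u≢v)
      own-row : ∀ x → ind (⌊ v ≟ v ⌋ ∧ not ⌊ x ≟ v ⌋ ∧ adj v x) 1 ≡ ind (adj v x) 1
      own-row x rewrite ≟-refl v with x ≟ v
      ... | yes refl = cong (λ b → ind b 1) (sym (irref x))
      ... | no _ = refl

  minCut≤degree : ∀ {X} → IsMinCut G X → ∀ v → d G X ≤ degree G v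
  minCut≤degree {X} (((u₁ , Xu₁) , (u₂ , Xu₂)) , minimal) v =
    subst (d G X ≤_) (d-singleton v) (minimal (λ x → ⌊ x ≟ v ⌋) ((v , ≟-refl v) , other))
    where
      u₁≢u₂ : u₁ ≢ u₂
      u₁≢u₂ refl = true≢false Xu₁ Xu₂
      other : ∃ λ w → ⌊ w ≟ v ⌋ ≡ false
      other with v ≟ u₁
      ... | yes refl = u₂ , ≟-false (u₁≢u₂ ∘ sym)
      ... | no v≢u₁ = u₁ , ≟-false (v≢u₁ ∘ sym)

  minCut≤δ : ∀ {X} → IsMinCut G X → d G X ≤ δ G
  minCut≤δ {X} mc@(((u , _) , _) , _) =
    foldr-⊓-glb (degree G) (allFin n) degree-bound (minCut≤degree mc)
    where
      degree-bound : d G X ≤ n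
      degree-bound = ≤-trans (minCut≤degree mc u) (subst (_≤ n) (sym (count≡card (adj u))) (card≤ (adj u)))

  -- A vertex u of X has fewer than |X| neighbours in X (it is not its own neighbour), and its
  -- remaining edges leave X; as it has at least δ neighbours, δ + 1 ≤ |X| + #(edges leaving X at u).
  neighbours-inside< : ∀ X u → X u ≡ true → card (λ v → X v ∧ adj u v) < card X
  neighbours-inside< X u Xu = sum-mono-< u below at-u
    where
      below : ∀ v → ind (X v ∧ adj u v) 1 ≤ ind (X v) 1
      below v with X v | adj u v
      ... | true | true = ≤-refl
      ... | true | false = z≤n
      ... | false | _ = z≤n
      at-u : ind (X u ∧ adj u u) 1 < ind (X u) 1
      at-u rewrite Xu | irref u = ≤-refl

  degree-split : ∀ X u → X u ≡ true → card (adj u) ≡ card (λ v → X v ∧ adj u v) + card (leaves X u)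
  degree-split X u Xu = trans (sum-cong-≗ split) (∑-distrib-+ (λ v → ind (X v ∧ adj u v) 1) (λ v → ind (leaves X u v) 1))
    where
      split : ∀ v → ind (adj u v) 1 ≡ ind (X v ∧ adj u v) 1 + ind (X u ∧ not (X v) ∧ adj u v) 1
      split v rewrite Xu with X v
      ... | true = sym (+-identityʳ _)
      ... | false = refl

  vertex-bound : ∀ X u → ind (X u) (suc (δ G)) ≤ ind (X u) (card X) + card (leaves X u)
  vertex-bound X u = by-membership (X u) refl
    where
      by-membership : ∀ b → X u ≡ b → ind b (suc (δ G)) ≤ ind b (card X) + card (leaves X u)
      by-membership false _ = z≤n
      by-membership true Xu = begin
          suc (δ G)                                              ≤⟨ s≤s (δ≤degree u) ⟩
          suc (degree G u)                                       ≡⟨ cong suc (trans (count≡card (adj u)) (degree-split X u Xu)) ⟩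
          suc (card (λ v → X v ∧ adj u v)) + card (leaves X u)   ≤⟨ +-monoˡ-≤ (card (leaves X u)) (neighbours-inside< X u Xu) ⟩
          card X + card (leaves X u)                             ∎
        where open ≤-Reasoning

  local-bound : ∀ X → card X * suc (δ G) ≤ card X * card X + d G X
  local-bound X = begin
      card X * suc (δ G)
        ≡⟨ sym (sum-ind-const X (suc (δ G))) ⟩
      ∑[ u < n ] ind (X u) (suc (δ G))
        ≤⟨ sum-mono-≤ (vertex-bound X) ⟩
      ∑[ u < n ] (ind (X u) (card X) + card (leaves X u))
        ≡⟨ ∑-distrib-+ (λ u → ind (X u) (card X)) (λ u → card (leaves X u)) ⟩
      ∑[ u < n ] ind (X u) (card X) + ∑[ u < n ] card (leaves X u)
        ≡⟨ cong₂ _+_ (sum-ind-const X (card X)) (sym (d≡sum X)) ⟩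
      card X * card X + d G X ∎
    where open ≤-Reasoning

  boundary-cover : ∀ {a b} (X : VSet G) (sel : Fin a → Fin b → Bool) (Y : Fin a → Fin b → VSet G) →
    (∀ u v → leaves X u v ≡ true → ∃₂ λ i j → sel i j ≡ true × leaves (Y i j) v u ≡ true) →
    d G X ≤ ∑[ i < a ] ∑[ j < b ] ind (sel i j) (d G (Y i j))
  boundary-cover {a} {b} X sel Y crossed = begin
      d G X
        ≡⟨ d≡sum X ⟩
      ∑[ u < n ] ∑[ v < n ] ind (leaves X u v) 1
        ≤⟨ sum-mono-≤ (λ u → sum-mono-≤ (counted u)) ⟩
      ∑[ u < n ] ∑[ v < n ] ∑[ i < a ] ∑[ j < b ] F i j u v
        ≡⟨ ∑∑-interchange (λ u v i j → F i j u v) ⟩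
      ∑[ i < a ] ∑[ j < b ] ∑[ u < n ] ∑[ v < n ] F i j u v
        ≡⟨ sum-cong-≗ (λ i → sum-cong-≗ (λ j → cut-total i j)) ⟩
      ∑[ i < a ] ∑[ j < b ] ind (sel i j) (d G (Y i j)) ∎
    where
      open ≤-Reasoning
      F : Fin a → Fin b → Fin n → Fin n → ℕ
      F i j u v = ind (sel i j) (ind (leaves (Y i j) v u) 1)

      counted : ∀ u v → ind (leaves X u v) 1 ≤ ∑[ i < a ] ∑[ j < b ] F i j u v
      counted u v with leaves X u v in uv
      ... | false = z≤n
      ... | true with crossed u v uv
      ...   | i , j , sel-ij , vu =
        ≤-trans (subst₂ (λ s c → 1 ≤ ind s (ind c 1)) (sym sel-ij) (sym vu) ≤-refl)
                (≤-trans (term≤sum (λ j′ → F i j′ u v) j) (term≤sum (λ i′ → ∑[ j′ < b ] F i′ j′ u v) i))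

      cut-total : ∀ i j → ∑[ u < n ] ∑[ v < n ] F i j u v ≡ ind (sel i j) (d G (Y i j))
      cut-total i j = ≡.begin
          ∑[ u < n ] ∑[ v < n ] F i j u v
            ≡.≡⟨ ∑-comm (F i j) ⟩
          ∑[ v < n ] ∑[ u < n ] ind (sel i j) (ind (leaves (Y i j) v u) 1)
            ≡.≡⟨ sum-cong-≗ (λ v → sum-ind (sel i j) (λ u → ind (leaves (Y i j) v u) 1)) ⟩
          ∑[ v < n ] ind (sel i j) (card (leaves (Y i j) v))
            ≡.≡⟨ sum-ind (sel i j) (λ v → card (leaves (Y i j) v)) ⟩
          ind (sel i j) (∑[ v < n ] card (leaves (Y i j) v))
            ≡.≡⟨ cong (ind (sel i j)) (sym (d≡sum (Y i j))) ⟩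
          ind (sel i j) (d G (Y i j)) ≡.∎
        where module ≡ = ≡-Reasoning

Reach-snoc : ∀ {k} {R : Fin k → Fin k → Bool} {x y z} → Reach R x y → R y z ≡ true → Reach R x z
Reach-snoc here e = step e here
Reach-snoc (step e′ r) e = step e′ (Reach-snoc r e)

minusEdge-intro : ∀ {m} (te : Fin m → Fin m → Bool) {D B x y : Fin m} → te x y ≡ true →
                  x ≢ D ⊎ y ≢ B → x ≢ B ⊎ y ≢ D → minusEdge te D B x y ≡ true
minusEdge-intro te exy not-DB not-BD =
  cong₂ (λ t c → t ∧ not c) exy (cong₂ _∨_ (≟∧≟-false not-DB) (≟∧≟-false not-BD))

module ClosedNeighbourhood {m : ℕ} (te : Fin m → Fin m → Bool)
    (tsym : ∀ A B → te A B ≡ te B A) (tirref : ∀ A → te A A ≡ false)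
    (connected : ∀ A B → Reach te A B)
    (acyclic : ∀ A B → te A B ≡ true → ¬ Reach (minusEdge te A B) A B)
    (A : Fin m) where

  N : Fin m → Bool
  N Z = ⌊ Z ≟ A ⌋ ∨ te A Z

  N-centre : N A ≡ true
  N-centre = cong (_∨ te A A) (≟-refl A)

  N-neighbour : ∀ {Z} → te A Z ≡ true → N Z ≡ true
  N-neighbour {Z} eAZ = trans (cong (⌊ Z ≟ A ⌋ ∨_) eAZ) (∨-zeroʳ ⌊ Z ≟ A ⌋)

  N-inv : ∀ {Z} → N Z ≡ true → Z ≡ A ⊎ te A Z ≡ true
  N-inv {Z} NZ with Z ≟ A
  ... | yes Z≡A = inj₁ Z≡A
  ... | no _ = inj₂ NZ

  N-distinct : ∀ {Z Z′} → N Z ≡ true → N Z′ ≡ false → Z ≢ Z′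
  N-distinct NZ NZ′ refl = true≢false NZ NZ′

  outward : Fin m → Fin m → Bool
  outward x y = te x y ∧ not (N y)

  lastExit : ∀ {X Z} → Reach te X Z → N Z ≡ false →
    (N X ≡ false × Reach outward X Z) ⊎
    (∃₂ λ X′ Y′ → N X′ ≡ true × te X′ Y′ ≡ true × N Y′ ≡ false × Reach outward Y′ Z)
  lastExit here NZ = inj₁ (NZ , here)
  lastExit (step {X} {Y} eXY rest) NZ with lastExit rest NZ
  ... | inj₂ exit = inj₂ exit
  ... | inj₁ (NY , outY) with N X in NX
  ...   | true = inj₂ (X , Y , NX , eXY , NY , outY)
  ...   | false = inj₁ (refl , step (cong₂ (λ t c → t ∧ not c) eXY NY) outY)

  outward⇒minusEdge : ∀ {D B x z} → N B ≡ true → N x ≡ false → Reach outward x z →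
                      Reach (minusEdge te D B) x z
  outward⇒minusEdge NB Nx here = here
  outward⇒minusEdge {B = B} {x = x} NB Nx (step {y = y} exy rest) =
    step (minusEdge-intro te te-xy (inj₂ y≢B) (inj₁ x≢B)) (outward⇒minusEdge NB Ny rest)
    where
      te-xy : te x y ≡ true
      te-xy = proj₁ (∧-true exy)
      Ny : N y ≡ false
      Ny = not-true (proj₂ (∧-true {te x y} exy))
      y≢B : y ≢ B
      y≢B = N-distinct NB Ny ∘ sym
      x≢B : x ≢ B
      x≢B = N-distinct NB Nx ∘ sym

  findExit : ∀ Z → N Z ≡ false → ∃₂ λ B D →
    te A B ≡ true × te D B ≡ true × N D ≡ false × InCAB te D B Z
  findExit Z NZ with lastExit (connected A Z) NZ
  ... | inj₁ (NA , _) = ⊥-elim (true≢false N-centre NA)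
  ... | inj₂ (X , Y , NX , eXY , NY , outY) with N-inv NX
  ...   | inj₁ refl = ⊥-elim (true≢false (N-neighbour eXY) NY)
  ...   | inj₂ eAX = X , Y , eAX , trans (tsym Y X) eXY , NY ,
                     outward⇒minusEdge (N-neighbour eAX) NY outY

  -- Conversely no block of N[A] lies in such a C_DB: from it D would reach A and then B
  -- in T - DB, although DB is a bridge.
  exit-separates : ∀ {B D Z} → te A B ≡ true → te D B ≡ true → N D ≡ false →
                   InCAB te D B Z → N Z ≡ true → ⊥
  exit-separates {B} {D} {Z} eAB eDB ND reach NZ = acyclic D B eDB (reach-B (N-inv NZ))
    where
      A≢D : A ≢ D
      A≢D = N-distinct N-centre ND
      A≢B : A ≢ B
      A≢B refl = true≢false eAB (tirref A)
      step-AB : minusEdge te D B A B ≡ true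
      step-AB = minusEdge-intro te eAB (inj₁ A≢D) (inj₁ A≢B)
      reach-B : Z ≡ A ⊎ te A Z ≡ true → Reach (minusEdge te D B) D B
      reach-B (inj₁ refl) = Reach-snoc reach step-AB
      reach-B (inj₂ eAZ) = Reach-snoc (Reach-snoc reach step-ZA) step-AB
        where
          step-ZA : minusEdge te D B Z A ≡ true
          step-ZA = minusEdge-intro te (trans (tsym Z A) eAZ) (inj₂ A≢B) (inj₂ A≢D)

module Lemma6Setting (G : Graph) (T : NTMinCutTree G) (A : Fin (NTMinCutTree.m T)) (r : ℕ)
    (degT-A : NTMinCutTree.degT T A ≡ r)
    (size-A : NTMinCutTree.size T A ≡ 1)
    (neighbours : ∀ B → NTMinCutTree.te T A B ≡ true →
                  (NTMinCutTree.degT T B ≡ 2) × (NTMinCutTree.size T B ≡ 1)) where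
  open Graph G renaming (sym to adj-sym)
  open NTMinCutTree T
  open ClosedNeighbourhood te tsym tirref connected acyclic A

  W : VSet G
  W u = N (β u)

  card-N : card N ≡ suc r
  card-N = begin
      card N                                   ≡⟨ card-remove N A N-centre ⟩
      suc (card (λ Z → N Z ∧ not ⌊ Z ≟ A ⌋))   ≡⟨ cong suc (sum-cong-≗ punctured) ⟩
      suc (card (te A))                        ≡⟨ cong suc (trans (sym (count≡card (te A))) degT-A) ⟩
      suc r                                    ∎
    where
      open ≡-Reasoning
      punctured : ∀ Z → ind ((⌊ Z ≟ A ⌋ ∨ te A Z) ∧ not ⌊ Z ≟ A ⌋) 1 ≡ ind (te A Z) 1
      punctured Z with Z ≟ A
      ... | yes refl = cong (λ b → ind b 1) (sym (tirref Z))
      ... | no _ = cong (λ b → ind b 1) (∧-identityʳ (te A Z))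

  card-W : card W ≡ suc r
  card-W = begin
      card (N ∘ β)                                            ≡⟨ card-fibres β N ⟩
      ∑[ Z < m ] ind (N Z) (card (λ u → ⌊ β u ≟ Z ⌋))        ≡⟨ sum-cong-≗ (λ Z → singleton-blocks Z (N Z) refl) ⟩
      card N                                                  ≡⟨ card-N ⟩
      suc r                                                   ∎
    where
      open ≡-Reasoning
      singleton-blocks : ∀ Z b → N Z ≡ b → ind b (card (λ u → ⌊ β u ≟ Z ⌋)) ≡ ind b 1
      singleton-blocks Z false _ = refl
      singleton-blocks Z true NZ with N-inv NZ
      ... | inj₁ refl = trans (sym (count≡card (λ u → ⌊ β u ≟ Z ⌋))) size-A
      ... | inj₂ eAZ = trans (sym (count≡card (λ u → ⌊ β u ≟ Z ⌋))) (proj₂ (neighbours Z eAZ))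

  -- the min-cut C_DB of condition (i) when D B is an edge of T, and ∅ otherwise
  cutAt : ∀ D B (b : Bool) → te D B ≡ b → VSet G
  cutAt D B true eDB = proj₁ (cond-i D B eDB)
  cutAt D B false _ = λ _ → false

  C : Fin m → Fin m → VSet G
  C D B = cutAt D B (te D B) refl

  C-spec : ∀ D B → te D B ≡ true →
           (∀ v → (C D B v ≡ true) ⇔ InCAB te D B (β v)) × IsNonTrivialMinCut G (C D B)
  C-spec D B = at (te D B) refl
    where
      at : ∀ b (e : te D B ≡ b) → b ≡ true →
           (∀ v → (cutAt D B b e v ≡ true) ⇔ InCAB te D B (β v)) × IsNonTrivialMinCut G (cutAt D B b e)
      at true eDB _ = proj₂ (cond-i D B eDB)

  exitEdge : Fin m → Fin m → Bool
  exitEdge B D = te A B ∧ te D B ∧ not ⌊ D ≟ A ⌋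

  -- a neighbour B of A, having T-degree 2, lies on exactly one exit edge
  -- (the statement unfolds exitEdge B so that the case split on te A B reaches it)
  card-exitEdge : ∀ B → card (λ D → te A B ∧ te D B ∧ not ⌊ D ≟ A ⌋) ≡ ind (te A B) 1
  card-exitEdge B with te A B in eAB
  ... | false = sum-replicate-zero m
  ... | true = suc-injective (begin
      suc (card (λ D → te D B ∧ not ⌊ D ≟ A ⌋))   ≡⟨ card-remove (λ D → te D B) A eAB ⟨
      card (λ D → te D B)                          ≡⟨ sum-cong-≗ (λ D → cong (λ b → ind b 1) (tsym D B)) ⟩
      card (te B)                                  ≡⟨ trans (sym (count≡card (te B))) (proj₁ (neighbours B eAB)) ⟩
      2                                            ∎)
    where open ≡-Reasoning

  exits-cover : ∀ u v → leaves G W u v ≡ true →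
                ∃₂ λ B D → exitEdge B D ≡ true × leaves G (C D B) v u ≡ true
  exits-cover u v uv with findExit (β v) (not-true (proj₁ (∧-true (proj₂ (∧-true {W u} uv)))))
  ... | B , D , eAB , eDB , ND , v-beyond = B , D , exit-BD , crosses
    where
      spec : (∀ w → (C D B w ≡ true) ⇔ InCAB te D B (β w)) × IsNonTrivialMinCut G (C D B)
      spec = C-spec D B eDB
      exit-BD : exitEdge B D ≡ true
      exit-BD = trans (cong₂ (λ a b → a ∧ b ∧ not ⌊ D ≟ A ⌋) eAB eDB)
                      (cong not (≟-false (N-distinct N-centre ND ∘ sym)))
      Cv : C D B v ≡ true
      Cv = Equivalence.from (proj₁ spec v) v-beyond
      Cu : C D B u ≡ false
      Cu with C D B u in Cu-true
      ... | false = refl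
      ... | true = ⊥-elim (exit-separates eAB eDB ND (Equivalence.to (proj₁ spec u) Cu-true)
                                           (proj₁ (∧-true uv)))
      crosses : leaves G (C D B) v u ≡ true
      crosses = trans (cong₂ (λ a b → a ∧ not b ∧ adj v u) Cv Cu)
                      (trans (adj-sym v u) (proj₂ (∧-true (proj₂ (∧-true {W u} uv)))))

  -- d(W) ≤ r·δ: the r cuts C_DB cover the boundary of W and each is at most δ
  d-W≤ : d G W ≤ r * δ G
  d-W≤ = begin
      d G W
        ≤⟨ boundary-cover G W exitEdge (λ B D → C D B) exits-cover ⟩
      ∑[ B < m ] ∑[ D < m ] ind (exitEdge B D) (d G (C D B))
        ≤⟨ sum-mono-≤ (λ B → sum-mono-≤ (λ D → cut≤δ B D (exitEdge B D) refl)) ⟩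
      ∑[ B < m ] ∑[ D < m ] ind (exitEdge B D) (δ G)
        ≡⟨ sum-cong-≗ (λ B → trans (sum-ind-const (exitEdge B) (δ G)) (cong (_* δ G) (card-exitEdge B))) ⟩
      ∑[ B < m ] (ind (te A B) 1 * δ G)
        ≡⟨ *-distribʳ-sum (δ G) (λ B → ind (te A B) 1) ⟨
      card (te A) * δ G
        ≡⟨ cong (_* δ G) (trans (sym (count≡card (te A))) degT-A) ⟩
      r * δ G ∎
    where
      open ≤-Reasoning
      cut≤δ : ∀ B D b → exitEdge B D ≡ b → ind b (d G (C D B)) ≤ ind b (δ G)
      cut≤δ B D false _ = z≤n
      cut≤δ B D true e = minCut≤δ G (proj₁ (proj₂ (C-spec D B (proj₁ (∧-true (proj₂ (∧-true {te A B} e)))))))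

quadratic-bound : ∀ r x → suc r * suc x ≤ suc r * suc r + r * x → x ≤ r * r + r
quadratic-bound r x le = +-cancelˡ-≤ (r * x + suc r) _ _ (subst₂ _≤_ (lhs r x) (rhs r x) le)
  where
    lhs : ∀ r x → suc r * suc x ≡ (r * x + suc r) + x
    lhs = solve-∀
    rhs : ∀ r x → suc r * suc r + r * x ≡ (r * x + suc r) + (r * r + r)
    rhs = solve-∀

lemma6 : (G : Graph) (T : NTMinCutTree G) (A : Fin (NTMinCutTree.m T)) (r : ℕ) →
    NTMinCutTree.degT T A ≡ r →
    NTMinCutTree.size T A ≡ 1 →
    (∀ B → NTMinCutTree.te T A B ≡ true →
      (NTMinCutTree.degT T B ≡ 2) × (NTMinCutTree.size T B ≡ 1)) →
    δ G ≤ r * r + r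
lemma6 G T A r degT-A size-A neighbours = quadratic-bound r (δ G) counting
  where
    open Lemma6Setting G T A r degT-A size-A neighbours
    counting : suc r * suc (δ G) ≤ suc r * suc r + r * δ G
    counting = subst (λ k → k * suc (δ G) ≤ k * k + r * δ G) card-W
                     (≤-trans (local-bound G W) (+-monoʳ-≤ (card W * card W) d-W≤))
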